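{- Let $n\ge 3$ and let $l_1=\{a_1,b_1\},\dots,l_n=\{a_n,b_n\}$ be pairwise disjoint $2$-element sets. Let $\mathcal{T}$ be a set of transversals of $(l_1,\dots,l_n)$ such that $|T_1-T_2|\ne 1$ for all $T_1,T_2\in\mathcal{T}$. Then there exists a unique spike $M$ with legs $l_1,\dots,l_n$ such that $\mathcal{T}(M)=\mathcal{T}$.
   Context: A rank-$n$ spike ($n\ge 3$): let $N$ be a rank-$n$ matroid with ground set $\{t,a_1,b_1,\dots,a_n,b_n\}$ such that $\{t,a_i,b_i\}$ is a triangle for every $i$, and $r(\bigcup_{j\in J}\{a_j,b_j\})=|J|+1$ for every nonempty proper subset $J$ of $\{1,\dots,n\}$; then $M=N\setminus t$ is a spike with legs $\{a_i,b_i\}$. A transversal of $(l_1,\dots,l_n)$ is a set with exactly one element from each $l_i$. $\mathcal{T}(M)$ denotes the set of transversals of the legs that are dependent in $M$. -}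

module Defs where

open import Data.Nat using (ℕ; zero; suc; _+_; _*_; _≤_; _<_)
open import Data.Bool using (Bool; true; false)
open import Data.Fin using (Fin; zero; suc; remQuot)
open import Data.Fin.Subset using (Subset; ∣_∣; _⊆_; _⊂_; _─_; ⊤; Nonempty; _∈_)
open import Data.Vec using (Vec; _∷_; lookup; tabulate)
open import Data.Product using (Σ; _×_; _,_; proj₁; proj₂)
open import Relation.Binary.PropositionalEquality using (_≡_; _≢_)
open import Function.Bundles using (_⇔_)

record Matroid (m : ℕ) : Set where
  field
    rank      : Subset m → ℕ
    rank-≤    : ∀ X → rank X ≤ ∣ X ∣
    rank-mono : ∀ X Y → X ⊆ Y → rank X ≤ rank Y
    rank-sub  : ∀ X Y →
      rank (Data.Fin.Subset._∪_ X Y) + rank (Data.Fin.Subset._∩_ X Y) ≤ rank X + rank Y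
open Matroid public

Independent : ∀ {m} → Matroid m → Subset m → Set
Independent M X = rank M X ≡ ∣ X ∣

Dependent : ∀ {m} → Matroid m → Subset m → Set
Dependent M X = rank M X < ∣ X ∣

Circuit : ∀ {m} → Matroid m → Subset m → Set
Circuit M C = Dependent M C × (∀ D → D ⊂ C → Independent M D)

-- Element encoding: the ground set of the spike is Fin (n * 2);
-- element x lies on leg i = proj₁ (remQuot 2 x); side zero is a_i, side (suc zero) is b_i.
-- For the extension N the ground set is Fin (suc (n * 2)) with t = zero,
-- and a subset of E(N) - t is written  false ∷ X.

legsSet : ∀ {n} → Subset n → Subset (n * 2)
legsSet {n} J = tabulate (λ x → lookup J (proj₁ (remQuot {n} 2 x)))

-- side selector: a transversal is a Vec Bool n, false = a_i chosen, true = b_i chosen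
chosen : Bool → Fin 2 → Bool
chosen false zero = true
chosen true (suc zero) = true
chosen _ _ = false

transSet : ∀ {n} → Vec Bool n → Subset (n * 2)
transSet {n} T = tabulate (λ x → chosen (lookup T (proj₁ (remQuot {n} 2 x))) (proj₂ (remQuot {n} 2 x)))

IsSpike : (n : ℕ) → Matroid (n * 2) → Set
IsSpike n M =
  Σ (Matroid (suc (n * 2))) λ N →
      (rank N ⊤ ≡ n)
    × (∀ (i : Fin n) → Circuit N (true ∷ legsSet (Data.Fin.Subset.⁅_⁆ i)))
    × (∀ (J : Subset n) → Nonempty J → J ≢ ⊤ → rank N (false ∷ legsSet J) ≡ ∣ J ∣ + 1)
    × (∀ (X : Subset (n * 2)) → rank M X ≡ rank N (false ∷ X))

DepTransversalsAre : ∀ {n} → Matroid (n * 2) → (Vec Bool n → Bool) → Set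
DepTransversalsAre {n} M 𝒯 = ∀ (T : Vec Bool n) → Dependent M (transSet T) ⇔ (𝒯 T ≡ true)

SameMatroid : ∀ {m} → Matroid m → Matroid m → Set
SameMatroid {m} M M' = ∀ (X : Subset m) → rank M X ≡ rank M' X

-- For X ⊆ E(M) let k(X) be the number of legs meeting X.  The
-- free spike of rank n has r(X) = min(n, k(X) + [X contains a leg]) and r(t ∪ X) = min(n, k(X) + 1);
-- N arises from it by lowering the rank of each transversal in 𝒯 from n to n − 1, i.e. by making
-- these transversals circuit-hyperplanes.  Submodularity of the free spike is checked leg by leg.
-- At a lowered transversal T it reduces to r(T ∩ Y) < r(Y) whenever T ∪ Y is not lowered; for Y
-- another member of 𝒯 this says k(T ∩ Y) = n − |T − Y| ≤ n − 2, which is the hypothesis on 𝒯.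
--
-- Conversely, in any spike with tip t the set t ∪ X spans every leg that X meets, which forces
-- r(t ∪ X) = min(n, k(X) + 1), and deleting t lowers the rank by at most one.  This determines
-- r(X): it is r(t ∪ X) if X contains a leg, k(X) if X is a partial transversal, and n or n − 1
-- on a transversal according to whether it lies in 𝒯.

module Submission where

open import Defs
open import Algebra using (CommutativeMonoid)
open import Data.Bool using (Bool; true; false; _∨_; _∧_; not)
open import Data.Bool.Properties
  using (∧-comm; ∧-zeroʳ; ∨-identityʳ; ∨-zeroʳ; ∨-assoc; ∨-commutativeMonoid)
open import Data.Fin as Fin using (Fin; zero; suc; combine; remQuot)
open import Data.Fin.Properties using (remQuot-combine; combine-remQuot; combine-injectiveʳ)
open import Data.Fin.Subset
  using (Subset; ∣_∣; _∪_; _∩_; _─_; _-_; _⊆_; _⊂_; _∈_; _∉_; ⁅_⁆; ⊤; ⊥; Nonempty)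
open import Data.Fin.Subset.Induction using (⊂-wellFounded)
open import Data.Fin.Subset.Properties
  using ( ⊆-antisym; ⊆-min; p⊆p∪q; q⊆p∪q; p∩q⊆p; p∩q⊆q; x∈p∩q⁺; x∈p∪q⁻; ∪-comm; ∩-comm; ∪-assoc; ∪-idem
        ; ∩-abs-∪; x∈⁅x⁆; x∈⁅y⁆⇒x≡y; ∣⁅x⁆∣≡1; ∣p∣≤n; ∣p∣≡n⇒p≡⊤; ∣⊤∣≡n; ∣⊥∣≡0; p⊂q⇒∣p∣<∣q∣
        ; drop-there; drop-∷-⊆; s⊆s; in⊆in; out⊆; nonempty?; Empty-unique
        ; x∈p⇒p-x⊂p; x∈p∧x≢y⇒x∈p-y; p─q⊆p )
open import Data.Maybe as Maybe using (Maybe; just; nothing; maybe)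
open import Data.Nat using (ℕ; zero; suc; _+_; _*_; _∸_; _⊓_; _≤_; _<_; _≤?_; _≟_; z≤n; s≤s)
open import Data.Nat.Properties
open import Data.Product using (Σ; _×_; _,_; proj₁; proj₂)
open import Data.Sum using (_⊎_; inj₁; inj₂; [_,_]′)
open import Data.Vec using (Vec; []; _∷_; here; there; lookup)
open import Data.Vec.Properties using ([]=⇒lookup; lookup⇒[]=; lookup∘tabulate)
open import Function using (id; _∘_; _⇔_; mk⇔; Equivalence; case_of_)
open import Induction.WellFounded using (module All)
open import Level using (0ℓ)
open import Relation.Binary.PropositionalEquality
open import Relation.Nullary using (¬_; contradiction; yes; no)
open import Relation.Nullary.Decidable using (True; toWitness)

open import Algebra.Properties.CommutativeSemigroup +-commutativeSemigroup using (interchange; x∙yz≈y∙xz)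
open import Algebra.Properties.CommutativeSemigroup
  (CommutativeMonoid.commutativeSemigroup ∨-commutativeMonoid)
  using () renaming (interchange to ∨-interchange)

⟦_⟧ : Bool → ℕ
⟦ false ⟧ = 0
⟦ true  ⟧ = 1

⟦⟧≤1 : ∀ b → ⟦ b ⟧ ≤ 1
⟦⟧≤1 false = z≤n
⟦⟧≤1 true  = ≤-refl

⟦⟧≤⟦∨⟧ : ∀ a b → ⟦ b ⟧ ≤ ⟦ a ∨ b ⟧
⟦⟧≤⟦∨⟧ false b = ≤-refl
⟦⟧≤⟦∨⟧ true  b = ⟦⟧≤1 b

⟦∧⟧≤⟦⟧ : ∀ a b → ⟦ a ∧ b ⟧ ≤ ⟦ b ⟧
⟦∧⟧≤⟦⟧ false b = z≤n
⟦∧⟧≤⟦⟧ true  b = ≤-refl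

⟦∨⟧≤⟦⟧+⟦⟧ : ∀ a b → ⟦ a ∨ b ⟧ ≤ ⟦ a ⟧ + ⟦ b ⟧
⟦∨⟧≤⟦⟧+⟦⟧ false b = ≤-refl
⟦∨⟧≤⟦⟧+⟦⟧ true  b = m≤m+n 1 ⟦ b ⟧

⟦∨⟧+⟦⟧≤⟦⟧+⟦⟧ : ∀ p q r → (r ≡ true → p ∧ q ≡ true) → ⟦ p ∨ q ⟧ + ⟦ r ⟧ ≤ ⟦ p ⟧ + ⟦ q ⟧
⟦∨⟧+⟦⟧≤⟦⟧+⟦⟧ p     q     false _ = ≤-trans (≤-reflexive (+-identityʳ _)) (⟦∨⟧≤⟦⟧+⟦⟧ p q)
⟦∨⟧+⟦⟧≤⟦⟧+⟦⟧ true  true  true  _ = ≤-refl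
⟦∨⟧+⟦⟧≤⟦⟧+⟦⟧ true  false true  r⇒pq with () ← r⇒pq refl
⟦∨⟧+⟦⟧≤⟦⟧+⟦⟧ false q     true  r⇒pq with () ← r⇒pq refl

∧∨⇒∨∧ : ∀ t₁ t₂ {i x y} → (i ≡ true → x ≡ true) → (i ≡ true → y ≡ true) →
        (t₁ ∧ t₂) ∨ i ≡ true → (t₁ ∨ x) ∧ (t₂ ∨ y) ≡ true
∧∨⇒∨∧ true  true  _    _    _ = refl
∧∨⇒∨∧ true  false _    i⇒y e = i⇒y e
∧∨⇒∨∧ false t₂    i⇒x i⇒y e rewrite i⇒x e | i⇒y e = ∨-zeroʳ t₂

Bool-cases : ∀ {P : Set} b → (b ≡ true → P) → (b ≡ false → P) → P
Bool-cases true  onTrue _       = onTrue refl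
Bool-cases false _      onFalse = onFalse refl

+-⊓-mono : ∀ {a b c d} m → a + b ≤ c + d → b ≤ c → b ≤ d → a ⊓ m + b ⊓ m ≤ c ⊓ m + d ⊓ m
+-⊓-mono {a} {b} {c} {d} m ab≤cd b≤c b≤d with m ≤? c | m ≤? d
... | yes m≤c | _ rewrite m≥n⇒m⊓n≡n m≤c = +-mono-≤ (m⊓n≤n a m) (⊓-monoˡ-≤ m b≤d)
... | no _ | yes m≤d rewrite m≥n⇒m⊓n≡n m≤d =
  subst (_≤ c ⊓ m + m) (+-comm (b ⊓ m) (a ⊓ m)) (+-mono-≤ (⊓-monoˡ-≤ m b≤c) (m⊓n≤n a m))
... | no m≰c | no m≰d rewrite m≤n⇒m⊓n≡m (<⇒≤ (≰⇒> m≰c)) | m≤n⇒m⊓n≡m (<⇒≤ (≰⇒> m≰d)) =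
  ≤-trans (+-mono-≤ (m⊓n≤m a m) (m⊓n≤m b m)) ab≤cd

+≡⇒<∸1 : ∀ {d k m} → d + k ≡ m → d ≢ 0 → d ≢ 1 → k < m ∸ 1
+≡⇒<∸1 {zero}        _    d≢0 _   = contradiction refl d≢0
+≡⇒<∸1 {suc zero}    _    _   d≢1 = contradiction refl d≢1
+≡⇒<∸1 {suc (suc d)} {k} refl _ _ = s≤s (m≤n+m k d)

<⇒≤∸1 : ∀ {m n} → m < n → m ≤ n ∸ 1
<⇒≤∸1 {m} {n} m<n = subst (m ≤_) (pred[m∸n]≡m∸[1+n] n 0) (suc[m]≤n⇒m≤pred[n] m<n)

+-≤-∸1 : ∀ {m u i b} → 1 ≤ m → u ≤ m → i < b → u + i ≤ (m ∸ 1) + b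
+-≤-∸1 {m} {u} {i} {b} 1≤m u≤m i<b = begin
  u + i             ≤⟨ +-monoˡ-≤ i u≤m ⟩
  m + i             ≡⟨ cong (_+ i) (m∸n+n≡m 1≤m) ⟨
  (m ∸ 1) + 1 + i   ≡⟨ +-assoc (m ∸ 1) 1 i ⟩
  (m ∸ 1) + suc i   ≤⟨ +-monoʳ-≤ (m ∸ 1) i<b ⟩
  (m ∸ 1) + b       ∎
  where open ≤-Reasoning

∣x∷p∣≡⟦x⟧+∣p∣ : ∀ {m} x (p : Subset m) → ∣ x ∷ p ∣ ≡ ⟦ x ⟧ + ∣ p ∣
∣x∷p∣≡⟦x⟧+∣p∣ false p = refl
∣x∷p∣≡⟦x⟧+∣p∣ true  p = refl

⊆⇒∩≡ : ∀ {m} {p q : Subset m} → p ⊆ q → p ∩ q ≡ p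
⊆⇒∩≡ {p = p} {q} p⊆q = ⊆-antisym (p∩q⊆p p q) (λ x∈p → x∈p∩q⁺ (x∈p , p⊆q x∈p))


∪≡⇒∩≡ : ∀ {m} (p q : Subset m) → p ∪ q ≡ p → p ∩ q ≡ q
∪≡⇒∩≡ p q p∪q≡p = begin
  p ∩ q       ≡⟨ cong (_∩ q) p∪q≡p ⟨
  (p ∪ q) ∩ q ≡⟨ ∩-comm (p ∪ q) q ⟩
  q ∩ (p ∪ q) ≡⟨ cong (q ∩_) (∪-comm p q) ⟩
  q ∩ (q ∪ p) ≡⟨ ∩-abs-∪ q p ⟩
  q           ∎
  where open ≡-Reasoning

∪-⊆ : ∀ {m} {A B C : Subset m} → A ⊆ C → B ⊆ C → A ∪ B ⊆ C
∪-⊆ {A = A} {B} A⊆C B⊆C x∈ = [ A⊆C , B⊆C ]′ (x∈p∪q⁻ A B x∈)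

⊆⇒∪≡ : ∀ {m} {p q : Subset m} → q ⊆ p → p ∪ q ≡ p
⊆⇒∪≡ {p = p} {q} q⊆p = ⊆-antisym (∪-⊆ id q⊆p) (p⊆p∪q q)

⁅⁆⊆ : ∀ {m} {e : Fin m} {A} → e ∈ A → ⁅ e ⁆ ⊆ A
⁅⁆⊆ {e = e} e∈A x∈⁅e⁆ with x∈⁅y⁆⇒x≡y e x∈⁅e⁆
... | refl = e∈A

1≤∣p∣⇒Nonempty : ∀ {m} (p : Subset m) → 1 ≤ ∣ p ∣ → Nonempty p
1≤∣p∣⇒Nonempty {m} p 1≤∣p∣ with nonempty? p
... | yes p≠∅ = p≠∅
... | no  p=∅ = contradiction (trans (sym (∣⊥∣≡0 m)) (cong ∣_∣ (sym (Empty-unique p=∅))))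
                            (≢-sym (m<n⇒n≢0 1≤∣p∣))

-- Counting legs

-- A count a with a flag b is dominated by c with d.  Unlike a + ⟦ b ⟧ ≤ c + ⟦ d ⟧ alone,
-- this survives adding counts and or-ing flags, which is how leg-wise facts are summed.
infix 4 _≼_
_≼_ : ℕ × Bool → ℕ × Bool → Set
(a , b) ≼ (c , d) = a ≤ c × a + ⟦ b ⟧ ≤ c + ⟦ d ⟧

≼-by-evaluation : ∀ {a b c d} {p : True (a ≤? c)} {q : True (a + ⟦ b ⟧ ≤? c + ⟦ d ⟧)} →
                  (a , b) ≼ (c , d)
≼-by-evaluation {p = p} {q} = toWitness p , toWitness q

≼-cong : ∀ {a a′ b b′ c c′ d d′} → a ≡ a′ → b ≡ b′ → c ≡ c′ → d ≡ d′ →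
         (a , b) ≼ (c , d) → (a′ , b′) ≼ (c′ , d′)
≼-cong refl refl refl refl p = p

+-∨-mono-≼ : ∀ {a b c d A B C D} → (a , b) ≼ (c , d) → (A , B) ≼ (C , D) →
             (a + A , b ∨ B) ≼ (c + C , d ∨ D)
+-∨-mono-≼ {a} {b} {c} {d} {A} {B} {C} {D} (a≤c , ab≤cd) (A≤C , AB≤CD) =
  +-mono-≤ a≤c A≤C , flagged b d ab≤cd
  where
  open ≤-Reasoning
  flagged : ∀ b d → a + ⟦ b ⟧ ≤ c + ⟦ d ⟧ → a + A + ⟦ b ∨ B ⟧ ≤ c + C + ⟦ d ∨ D ⟧
  flagged false d _ = begin
    a + A + ⟦ B ⟧       ≡⟨ +-assoc a A ⟦ B ⟧ ⟩
    a + (A + ⟦ B ⟧)     ≤⟨ +-mono-≤ a≤c AB≤CD ⟩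
    c + (C + ⟦ D ⟧)     ≤⟨ +-monoʳ-≤ c (+-monoʳ-≤ C (⟦⟧≤⟦∨⟧ d D)) ⟩
    c + (C + ⟦ d ∨ D ⟧) ≡⟨ +-assoc c C _ ⟨
    c + C + ⟦ d ∨ D ⟧   ∎
  flagged true true _ = +-monoˡ-≤ 1 (+-mono-≤ a≤c A≤C)
  flagged true false a+1≤c+0 = begin
    a + A + 1   ≡⟨ +-assoc a A 1 ⟩
    a + (A + 1) ≡⟨ cong (a +_) (+-comm A 1) ⟩
    a + (1 + A) ≡⟨ +-assoc a 1 A ⟨
    a + 1 + A   ≤⟨ +-mono-≤ (subst (a + 1 ≤_) (+-identityʳ c) a+1≤c+0) A≤C ⟩
    c + C       ≤⟨ m≤m+n (c + C) ⟦ D ⟧ ⟩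
    c + C + ⟦ D ⟧ ∎

≼⇒< : ∀ {a b c d} → b ≡ true → (a , b) ≼ (c , d) → a < c + ⟦ d ⟧
≼⇒< {a} {c = c} {d} refl (_ , a+1≤) = subst (_≤ c + ⟦ d ⟧) (+-comm a 1) a+1≤

legCount : ∀ n → Subset (n * 2) → ℕ
legCount zero    []          = 0
legCount (suc n) (x ∷ y ∷ X) = ⟦ x ∨ y ⟧ + legCount n X

hasFullLeg : ∀ n → Subset (n * 2) → Bool
hasFullLeg zero    []          = false
hasFullLeg (suc n) (x ∷ y ∷ X) = (x ∧ y) ∨ hasFullLeg n X

fullLegCount : ∀ n → Subset (n * 2) → ℕ
fullLegCount zero    []          = 0
fullLegCount (suc n) (x ∷ y ∷ X) = ⟦ x ∧ y ⟧ + fullLegCount n X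

legsMet : ∀ n → Subset (n * 2) → Subset n
legsMet zero    []          = []
legsMet (suc n) (x ∷ y ∷ X) = (x ∨ y) ∷ legsMet n X

_⊈ᵇ_ : ∀ {m} → Subset m → Subset m → Bool
[]      ⊈ᵇ []      = false
(x ∷ p) ⊈ᵇ (y ∷ q) = (x ∧ not y) ∨ (p ⊈ᵇ q)

leg-∪∩ : ∀ x y x′ y′ →
  (⟦ (x ∨ x′) ∨ (y ∨ y′) ⟧ + ⟦ (x ∧ x′) ∨ (y ∧ y′) ⟧ , (x ∨ x′) ∧ (y ∨ y′))
    ≼ (⟦ x ∨ y ⟧ + ⟦ x′ ∨ y′ ⟧ , (x ∧ y) ∨ (x′ ∧ y′))
leg-∪∩ true  true  true  true  = ≼-by-evaluation
leg-∪∩ true  true  true  false = ≼-by-evaluation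
leg-∪∩ true  true  false true  = ≼-by-evaluation
leg-∪∩ true  true  false false = ≼-by-evaluation
leg-∪∩ true  false true  true  = ≼-by-evaluation
leg-∪∩ true  false true  false = ≼-by-evaluation
leg-∪∩ true  false false true  = ≼-by-evaluation
leg-∪∩ true  false false false = ≼-by-evaluation
leg-∪∩ false true  true  true  = ≼-by-evaluation
leg-∪∩ false true  true  false = ≼-by-evaluation
leg-∪∩ false true  false true  = ≼-by-evaluation
leg-∪∩ false true  false false = ≼-by-evaluation
leg-∪∩ false false true  true  = ≼-by-evaluation
leg-∪∩ false false true  false = ≼-by-evaluation
leg-∪∩ false false false true  = ≼-by-evaluation
leg-∪∩ false false false false = ≼-by-evaluation

legCount-∪∩ : ∀ n (X Y : Subset (n * 2)) →
  (legCount n (X ∪ Y) + legCount n (X ∩ Y) , hasFullLeg n (X ∪ Y))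
    ≼ (legCount n X + legCount n Y , hasFullLeg n X ∨ hasFullLeg n Y)
legCount-∪∩ zero    []          []             = z≤n , z≤n
legCount-∪∩ (suc n) (x ∷ y ∷ X) (x′ ∷ y′ ∷ Y) =
  ≼-cong (interchange ⟦ (x ∨ x′) ∨ (y ∨ y′) ⟧ _ _ (legCount n (X ∩ Y))) refl
         (interchange ⟦ x ∨ y ⟧ _ _ (legCount n Y)) (∨-interchange (x ∧ y) _ _ (hasFullLeg n Y))
         (+-∨-mono-≼ (leg-∪∩ x y x′ y′) (legCount-∪∩ n X Y))

leg-card : ∀ x y → (⟦ x ∨ y ⟧ , x ∧ y) ≼ (⟦ x ⟧ + ⟦ y ⟧ , false)
leg-card true  true  = ≼-by-evaluation
leg-card true  false = ≼-by-evaluation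
leg-card false true  = ≼-by-evaluation
leg-card false false = ≼-by-evaluation

legCount≼∣∣ : ∀ n (X : Subset (n * 2)) → (legCount n X , hasFullLeg n X) ≼ (∣ X ∣ , false)
legCount≼∣∣ zero    []          = z≤n , z≤n
legCount≼∣∣ (suc n) (x ∷ y ∷ X) =
  ≼-cong refl refl ∣xy∷X∣ refl (+-∨-mono-≼ (leg-card x y) (legCount≼∣∣ n X))
  where
  ∣xy∷X∣ : ⟦ x ⟧ + ⟦ y ⟧ + ∣ X ∣ ≡ ∣ x ∷ y ∷ X ∣
  ∣xy∷X∣ = begin
    ⟦ x ⟧ + ⟦ y ⟧ + ∣ X ∣   ≡⟨ +-assoc ⟦ x ⟧ ⟦ y ⟧ ∣ X ∣ ⟩
    ⟦ x ⟧ + (⟦ y ⟧ + ∣ X ∣) ≡⟨ cong (⟦ x ⟧ +_) (∣x∷p∣≡⟦x⟧+∣p∣ y X) ⟨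
    ⟦ x ⟧ + ∣ y ∷ X ∣       ≡⟨ ∣x∷p∣≡⟦x⟧+∣p∣ x (y ∷ X) ⟨
    ∣ x ∷ y ∷ X ∣           ∎
    where open ≡-Reasoning

leg-∩ : ∀ x y x′ y′ → (⟦ (x ∧ x′) ∨ (y ∧ y′) ⟧ , (x ∧ x′) ∧ (y ∧ y′)) ≼ (⟦ x′ ∨ y′ ⟧ , x′ ∧ y′)
leg-∩ true  true  true  true  = ≼-by-evaluation
leg-∩ true  true  true  false = ≼-by-evaluation
leg-∩ true  true  false true  = ≼-by-evaluation
leg-∩ true  true  false false = ≼-by-evaluation
leg-∩ true  false true  true  = ≼-by-evaluation
leg-∩ true  false true  false = ≼-by-evaluation
leg-∩ true  false false true  = ≼-by-evaluation
leg-∩ true  false false false = ≼-by-evaluation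
leg-∩ false true  true  true  = ≼-by-evaluation
leg-∩ false true  true  false = ≼-by-evaluation
leg-∩ false true  false true  = ≼-by-evaluation
leg-∩ false true  false false = ≼-by-evaluation
leg-∩ false false true  true  = ≼-by-evaluation
leg-∩ false false true  false = ≼-by-evaluation
leg-∩ false false false true  = ≼-by-evaluation
leg-∩ false false false false = ≼-by-evaluation

legCount-∩ : ∀ n (X Y : Subset (n * 2)) →
  (legCount n (X ∩ Y) , hasFullLeg n (X ∩ Y)) ≼ (legCount n Y , hasFullLeg n Y)
legCount-∩ zero    []          []             = z≤n , z≤n
legCount-∩ (suc n) (x ∷ y ∷ X) (x′ ∷ y′ ∷ Y) = +-∨-mono-≼ (leg-∩ x y x′ y′) (legCount-∩ n X Y)

leg-transversal∩≼1 : ∀ b y₀ y₁ → let c₀ = chosen b zero; c₁ = chosen b (suc zero) in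
  (⟦ (c₀ ∧ y₀) ∨ (c₁ ∧ y₁) ⟧ , (c₀ ∧ not y₀) ∨ (c₁ ∧ not y₁)) ≼ (1 , false)
leg-transversal∩≼1 true  true  true  = ≼-by-evaluation
leg-transversal∩≼1 true  true  false = ≼-by-evaluation
leg-transversal∩≼1 true  false true  = ≼-by-evaluation
leg-transversal∩≼1 true  false false = ≼-by-evaluation
leg-transversal∩≼1 false true  true  = ≼-by-evaluation
leg-transversal∩≼1 false true  false = ≼-by-evaluation
leg-transversal∩≼1 false false true  = ≼-by-evaluation
leg-transversal∩≼1 false false false = ≼-by-evaluation

transversal∩≼n : ∀ n (v : Vec Bool n) Y → (legCount n (transSet v ∩ Y) , transSet v ⊈ᵇ Y) ≼ (n , false)
transversal∩≼n zero    []      []            = z≤n , z≤n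
transversal∩≼n (suc n) (b ∷ v) (y₀ ∷ y₁ ∷ Y) =
  ≼-cong refl (∨-assoc (chosen b zero ∧ not y₀) _ _) refl refl
         (+-∨-mono-≼ (leg-transversal∩≼1 b y₀ y₁) (transversal∩≼n n v Y))

transversal⊈⇒legCount∩<n : ∀ n (v : Vec Bool n) Y → transSet v ⊈ᵇ Y ≡ true →
                            legCount n (transSet v ∩ Y) < n
transversal⊈⇒legCount∩<n n v Y T⊈Y =
  ≤-trans (≼⇒< T⊈Y (transversal∩≼n n v Y)) (≤-reflexive (+-identityʳ n))

leg-transversal∩≼legCount : ∀ b y₀ y₁ → let c₀ = chosen b zero; c₁ = chosen b (suc zero) in
  (⟦ (c₀ ∧ y₀) ∨ (c₁ ∧ y₁) ⟧ , (y₀ ∧ not c₀) ∨ (y₁ ∧ not c₁)) ≼ (⟦ y₀ ∨ y₁ ⟧ , y₀ ∧ y₁)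
leg-transversal∩≼legCount true  true  true  = ≼-by-evaluation
leg-transversal∩≼legCount true  true  false = ≼-by-evaluation
leg-transversal∩≼legCount true  false true  = ≼-by-evaluation
leg-transversal∩≼legCount true  false false = ≼-by-evaluation
leg-transversal∩≼legCount false true  true  = ≼-by-evaluation
leg-transversal∩≼legCount false true  false = ≼-by-evaluation
leg-transversal∩≼legCount false false true  = ≼-by-evaluation
leg-transversal∩≼legCount false false false = ≼-by-evaluation

transversal∩≼legCount : ∀ n (v : Vec Bool n) Y →
  (legCount n (transSet v ∩ Y) , Y ⊈ᵇ transSet v) ≼ (legCount n Y , hasFullLeg n Y)
transversal∩≼legCount zero    []      []            = z≤n , z≤n
transversal∩≼legCount (suc n) (b ∷ v) (y₀ ∷ y₁ ∷ Y) =
  ≼-cong refl (∨-assoc (y₀ ∧ not (chosen b zero)) _ _) refl refl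
         (+-∨-mono-≼ (leg-transversal∩≼legCount b y₀ y₁) (transversal∩≼legCount n v Y))

∣∣≡legCount+fullLegCount : ∀ n X → ∣ X ∣ ≡ legCount n X + fullLegCount n X
∣∣≡legCount+fullLegCount zero    []                  = refl
∣∣≡legCount+fullLegCount (suc n) (true  ∷ true  ∷ X) =
  cong suc (trans (cong suc (∣∣≡legCount+fullLegCount n X)) (sym (+-suc _ _)))
∣∣≡legCount+fullLegCount (suc n) (true  ∷ false ∷ X) = cong suc (∣∣≡legCount+fullLegCount n X)
∣∣≡legCount+fullLegCount (suc n) (false ∷ true  ∷ X) = cong suc (∣∣≡legCount+fullLegCount n X)
∣∣≡legCount+fullLegCount (suc n) (false ∷ false ∷ X) = ∣∣≡legCount+fullLegCount n X

fullLegCount≤legCount : ∀ n X → fullLegCount n X ≤ legCount n X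
fullLegCount≤legCount zero    []                  = z≤n
fullLegCount≤legCount (suc n) (true  ∷ true  ∷ X) = s≤s (fullLegCount≤legCount n X)
fullLegCount≤legCount (suc n) (true  ∷ false ∷ X) = m≤n⇒m≤1+n (fullLegCount≤legCount n X)
fullLegCount≤legCount (suc n) (false ∷ true  ∷ X) = m≤n⇒m≤1+n (fullLegCount≤legCount n X)
fullLegCount≤legCount (suc n) (false ∷ false ∷ X) = fullLegCount≤legCount n X

hasFullLeg⇒1≤fullLegCount : ∀ n X → hasFullLeg n X ≡ true → 1 ≤ fullLegCount n X
hasFullLeg⇒1≤fullLegCount zero    []                  ()
hasFullLeg⇒1≤fullLegCount (suc n) (true  ∷ true  ∷ X) _ = s≤s z≤n
hasFullLeg⇒1≤fullLegCount (suc n) (true  ∷ false ∷ X) e = hasFullLeg⇒1≤fullLegCount n X e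
hasFullLeg⇒1≤fullLegCount (suc n) (false ∷ y     ∷ X) e = hasFullLeg⇒1≤fullLegCount n X e

¬hasFullLeg⇒fullLegCount≡0 : ∀ n X → hasFullLeg n X ≡ false → fullLegCount n X ≡ 0
¬hasFullLeg⇒fullLegCount≡0 zero    []                  _ = refl
¬hasFullLeg⇒fullLegCount≡0 (suc n) (true  ∷ false ∷ X) e = ¬hasFullLeg⇒fullLegCount≡0 n X e
¬hasFullLeg⇒fullLegCount≡0 (suc n) (false ∷ y     ∷ X) e = ¬hasFullLeg⇒fullLegCount≡0 n X e

legCount≡∣legsMet∣ : ∀ n X → legCount n X ≡ ∣ legsMet n X ∣
legCount≡∣legsMet∣ zero    []          = refl
legCount≡∣legsMet∣ (suc n) (x ∷ y ∷ X) =
  trans (cong (⟦ x ∨ y ⟧ +_) (legCount≡∣legsMet∣ n X)) (sym (∣x∷p∣≡⟦x⟧+∣p∣ (x ∨ y) (legsMet n X)))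

legCount≤n : ∀ n X → legCount n X ≤ n
legCount≤n n X = ≤-trans (≤-reflexive (legCount≡∣legsMet∣ n X)) (∣p∣≤n (legsMet n X))

legCount-⊤ : ∀ n → legCount n ⊤ ≡ n
legCount-⊤ zero    = refl
legCount-⊤ (suc n) = cong suc (legCount-⊤ n)

⊈ᵇ≡false⇒⊆ : ∀ {m} (p q : Subset m) → p ⊈ᵇ q ≡ false → p ⊆ q
⊈ᵇ≡false⇒⊆ (true  ∷ p) (true  ∷ q) e here      = here
⊈ᵇ≡false⇒⊆ (true  ∷ p) (true  ∷ q) e (there i) = there (⊈ᵇ≡false⇒⊆ p q e i)
⊈ᵇ≡false⇒⊆ (false ∷ p) (y     ∷ q) e (there i) = there (⊈ᵇ≡false⇒⊆ p q e i)
⊈ᵇ≡false⇒⊆ (true  ∷ p) (false ∷ q) () _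

-- Transversals

transversalSide : Bool → Bool → Maybe Bool
transversalSide true  false = just false
transversalSide false true  = just true
transversalSide _     _     = nothing

asTransversal : ∀ n → Subset (n * 2) → Maybe (Vec Bool n)
asTransversal zero    []          = just []
asTransversal (suc n) (x ∷ y ∷ X) = Maybe.zipWith _∷_ (transversalSide x y) (asTransversal n X)

asTransversal-transSet : ∀ n (v : Vec Bool n) → asTransversal n (transSet v) ≡ just v
asTransversal-transSet zero    []      = refl
asTransversal-transSet (suc n) (b ∷ v) rewrite asTransversal-transSet n v with b
... | false = refl
... | true  = refl

asTransversal-sound : ∀ n X {v} → asTransversal n X ≡ just v → X ≡ transSet v
asTransversal-sound zero    []                  refl = refl
asTransversal-sound (suc n) (true  ∷ false ∷ X) eq with asTransversal n X in e | eq
... | just _ | refl = cong (λ Z → true ∷ false ∷ Z) (asTransversal-sound n X e)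
asTransversal-sound (suc n) (false ∷ true  ∷ X) eq with asTransversal n X in e | eq
... | just _ | refl = cong (λ Z → false ∷ true ∷ Z) (asTransversal-sound n X e)

asTransversal-complete : ∀ n X → legCount n X ≡ n → hasFullLeg n X ≡ false →
                         Σ (Vec Bool n) λ v → asTransversal n X ≡ just v
asTransversal-complete zero    []                  _ _ = [] , refl
asTransversal-complete (suc n) (true  ∷ false ∷ X) e f
  with asTransversal-complete n X (suc-injective e) f
... | v , eq rewrite eq = false ∷ v , refl
asTransversal-complete (suc n) (false ∷ true  ∷ X) e f
  with asTransversal-complete n X (suc-injective e) f
... | v , eq rewrite eq = true ∷ v , refl
asTransversal-complete (suc n) (false ∷ false ∷ X) e _ =
  contradiction (legCount≤n n X) (<⇒≱ (≤-reflexive (sym e)))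

∣transSet∣ : ∀ n (v : Vec Bool n) → ∣ transSet v ∣ ≡ n
∣transSet∣ zero    []          = refl
∣transSet∣ (suc n) (false ∷ v) = cong suc (∣transSet∣ n v)
∣transSet∣ (suc n) (true  ∷ v) = cong suc (∣transSet∣ n v)

legCount-transSet : ∀ n (v : Vec Bool n) → legCount n (transSet v) ≡ n
legCount-transSet zero    []          = refl
legCount-transSet (suc n) (false ∷ v) = cong suc (legCount-transSet n v)
legCount-transSet (suc n) (true  ∷ v) = cong suc (legCount-transSet n v)

hasFullLeg-transSet : ∀ n (v : Vec Bool n) → hasFullLeg n (transSet v) ≡ false
hasFullLeg-transSet zero    []          = refl
hasFullLeg-transSet (suc n) (false ∷ v) = hasFullLeg-transSet n v
hasFullLeg-transSet (suc n) (true  ∷ v) = hasFullLeg-transSet n v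

transSet-⊆⇒≡ : ∀ n (v w : Vec Bool n) → transSet v ⊆ transSet w → v ≡ w
transSet-⊆⇒≡ zero    []          []          _   = refl
transSet-⊆⇒≡ (suc n) (false ∷ v) (false ∷ w) v⊆w =
  cong (false ∷_) (transSet-⊆⇒≡ n v w (drop-∷-⊆ (drop-∷-⊆ v⊆w)))
transSet-⊆⇒≡ (suc n) (true  ∷ v) (true  ∷ w) v⊆w =
  cong (true ∷_) (transSet-⊆⇒≡ n v w (drop-∷-⊆ (drop-∷-⊆ v⊆w)))
transSet-⊆⇒≡ (suc n) (false ∷ v) (true  ∷ w) v⊆w with v⊆w here
... | ()
transSet-⊆⇒≡ (suc n) (true  ∷ v) (false ∷ w) v⊆w with v⊆w (there here)
... | there ()

∣─∣+legCount∩≡n : ∀ n (v w : Vec Bool n) →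
  ∣ transSet v ─ transSet w ∣ + legCount n (transSet v ∩ transSet w) ≡ n
∣─∣+legCount∩≡n zero    []          []          = refl
∣─∣+legCount∩≡n (suc n) (false ∷ v) (false ∷ w) = trans (+-suc _ _) (cong suc (∣─∣+legCount∩≡n n v w))
∣─∣+legCount∩≡n (suc n) (false ∷ v) (true  ∷ w) = cong suc (∣─∣+legCount∩≡n n v w)
∣─∣+legCount∩≡n (suc n) (true  ∷ v) (false ∷ w) = cong suc (∣─∣+legCount∩≡n n v w)
∣─∣+legCount∩≡n (suc n) (true  ∷ v) (true  ∷ w) = trans (+-suc _ _) (cong suc (∣─∣+legCount∩≡n n v w))

∣─∣≡0⇒≡ : ∀ n (v w : Vec Bool n) → ∣ transSet v ─ transSet w ∣ ≡ 0 → v ≡ w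
∣─∣≡0⇒≡ zero    []          []          _ = refl
∣─∣≡0⇒≡ (suc n) (false ∷ v) (false ∷ w) e = cong (false ∷_) (∣─∣≡0⇒≡ n v w e)
∣─∣≡0⇒≡ (suc n) (true  ∷ v) (true  ∷ w) e = cong (true ∷_) (∣─∣≡0⇒≡ n v w e)

-- Elements of legs

legIndex : ∀ {n} → Fin (n * 2) → Fin n
legIndex {n} x = proj₁ (remQuot {n} 2 x)

sideIndex : ∀ {n} → Fin (n * 2) → Fin 2
sideIndex {n} x = proj₂ (remQuot {n} 2 x)

legElem : ∀ {n} → Fin n → Fin 2 → Fin (n * 2)
legElem {n} = combine {n} {2}

otherSide : Fin 2 → Fin 2
otherSide zero       = suc zero
otherSide (suc zero) = zero

otherSide≢ : ∀ s → s ≢ otherSide s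
otherSide≢ zero       ()
otherSide≢ (suc zero) ()

∈legsSet⁻ : ∀ {n} {J : Subset n} {x} → x ∈ legsSet J → legIndex x ∈ J
∈legsSet⁻ {n} {J} {x} x∈ = lookup⇒[]= (legIndex x) J (trans (sym (lookup∘tabulate _ x)) ([]=⇒lookup x∈))

∈legsSet⁺ : ∀ {n} {J : Subset n} {i} s → i ∈ J → legElem i s ∈ legsSet J
∈legsSet⁺ {n} {J} {i} s i∈ = lookup⇒[]= _ _ (begin
  lookup (legsSet J) (legElem i s)      ≡⟨ lookup∘tabulate _ (legElem i s) ⟩
  lookup J (legIndex (legElem {n} i s))    ≡⟨ cong (lookup J ∘ proj₁) (remQuot-combine {n} {2} i s) ⟩
  lookup J i                            ≡⟨ []=⇒lookup i∈ ⟩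
  true                                  ∎)
  where open ≡-Reasoning

legsSet-mono : ∀ {n} {J K : Subset n} → J ⊆ K → legsSet J ⊆ legsSet K
legsSet-mono {n} {J} {K} J⊆K {x} x∈ =
  lookup⇒[]= x (legsSet K) (trans (lookup∘tabulate _ x) ([]=⇒lookup (J⊆K (∈legsSet⁻ {n} x∈))))

legsSet-⊤ : ∀ n → legsSet {n} ⊤ ≡ ⊤
legsSet-⊤ zero    = refl
legsSet-⊤ (suc n) = cong (λ Z → true ∷ true ∷ Z) (legsSet-⊤ n)

legCount-legsSet : ∀ n (J : Subset n) → legCount n (legsSet J) ≡ ∣ J ∣
legCount-legsSet zero    []          = refl
legCount-legsSet (suc n) (true  ∷ J) = cong suc (legCount-legsSet n J)
legCount-legsSet (suc n) (false ∷ J) = legCount-legsSet n J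

∣legsSet∣ : ∀ n (J : Subset n) → ∣ legsSet J ∣ ≡ ∣ J ∣ + ∣ J ∣
∣legsSet∣ zero    []          = refl
∣legsSet∣ (suc n) (true  ∷ J) = cong suc (trans (cong suc (∣legsSet∣ n J)) (sym (+-suc ∣ J ∣ ∣ J ∣)))
∣legsSet∣ (suc n) (false ∷ J) = ∣legsSet∣ n J

∣leg∣≡2 : ∀ {n} (i : Fin n) → ∣ legsSet ⁅ i ⁆ ∣ ≡ 2
∣leg∣≡2 {n} i = trans (∣legsSet∣ n ⁅ i ⁆) (cong₂ _+_ (∣⁅x⁆∣≡1 i) (∣⁅x⁆∣≡1 i))

asTransversal-legsSet : ∀ n → 1 ≤ n → (J : Subset n) → asTransversal n (legsSet J) ≡ nothing
asTransversal-legsSet (suc n) _ (true  ∷ J) = refl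
asTransversal-legsSet (suc n) _ (false ∷ J) = refl

sides⇒leg⊆ : ∀ {n} {X : Subset (n * 2)} i → (∀ s → legElem {n} i s ∈ X) → legsSet ⁅ i ⁆ ⊆ X
sides⇒leg⊆ {n} {X} i both {x} x∈ with x∈⁅y⁆⇒x≡y i (∈legsSet⁻ {n} x∈)
... | refl = subst (_∈ X) (combine-remQuot {n} 2 x) (both (sideIndex {n} x))

hasFullLeg⇒sides : ∀ n (X : Subset (n * 2)) → hasFullLeg n X ≡ true →
                   Σ (Fin n) λ i → ∀ s → legElem {n} i s ∈ X
hasFullLeg⇒sides zero [] ()
hasFullLeg⇒sides (suc n) (true ∷ true ∷ X) _ = zero , λ { zero → here ; (suc zero) → there here }
hasFullLeg⇒sides (suc n) (true ∷ false ∷ X) e with hasFullLeg⇒sides n X e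
... | i , both = suc i , λ s → there (there (both s))
hasFullLeg⇒sides (suc n) (false ∷ y ∷ X) e with hasFullLeg⇒sides n X e
... | i , both = suc i , λ s → there (there (both s))

sides⇒hasFullLeg : ∀ n (X : Subset (n * 2)) i → (∀ s → legElem {n} i s ∈ X) → hasFullLeg n X ≡ true
sides⇒hasFullLeg (suc n) (x ∷ y ∷ X) zero both with both zero | both (suc zero)
... | here | there here = refl
sides⇒hasFullLeg (suc n) (x ∷ y ∷ X) (suc i) both =
  trans (cong ((x ∧ y) ∨_) (sides⇒hasFullLeg n X i (λ s → drop-there (drop-there (both s))))) (∨-zeroʳ _)

hasFullLeg-mono : ∀ n {X Y : Subset (n * 2)} → X ⊆ Y → hasFullLeg n X ≡ true → hasFullLeg n Y ≡ true
hasFullLeg-mono n {X} {Y} X⊆Y e with hasFullLeg⇒sides n X e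
... | i , both = sides⇒hasFullLeg n Y i (λ s → X⊆Y (both s))

hasFullLeg-transSet∩ : ∀ n (v : Vec Bool n) Y → hasFullLeg n (transSet v ∩ Y) ≡ false
hasFullLeg-transSet∩ n v Y with hasFullLeg n (transSet v ∩ Y) in e
... | false = refl
... | true  = contradiction (trans (sym (hasFullLeg-transSet n v)) (hasFullLeg-mono n (p∩q⊆p _ Y) e))
                            λ ()

∈legsMet⁺ : ∀ n X i s → legElem {n} i s ∈ X → i ∈ legsMet n X
∈legsMet⁺ (suc n) (true  ∷ y ∷ X) zero    zero       here             = here
∈legsMet⁺ (suc n) (x     ∷ y ∷ X) zero    (suc zero) (there here)
  rewrite ∨-zeroʳ x = here
∈legsMet⁺ (suc n) (x     ∷ y ∷ X) (suc i) s          (there (there p)) = there (∈legsMet⁺ n X i s p)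

∈legsMet⁻ : ∀ n X i → i ∈ legsMet n X → ∀ s → legElem {n} i s ∈ X ⊎ legElem {n} i (otherSide s) ∈ X
∈legsMet⁻ (suc n) (true  ∷ y    ∷ X) zero    here zero       = inj₁ here
∈legsMet⁻ (suc n) (true  ∷ y    ∷ X) zero    here (suc zero) = inj₂ here
∈legsMet⁻ (suc n) (false ∷ true ∷ X) zero    here zero       = inj₂ (there here)
∈legsMet⁻ (suc n) (false ∷ true ∷ X) zero    here (suc zero) = inj₁ (there here)
∈legsMet⁻ (suc n) (x     ∷ y    ∷ X) (suc i) (there p) s     =
  [ inj₁ ∘ there ∘ there , inj₂ ∘ there ∘ there ]′ (∈legsMet⁻ n X i p s)

⊆legsSet-legsMet : ∀ n X → X ⊆ legsSet (legsMet n X)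
⊆legsSet-legsMet n X {x} x∈X = subst (_∈ legsSet (legsMet n X)) (combine-remQuot {n} 2 x)
  (∈legsSet⁺ (sideIndex {n} x)
             (∈legsMet⁺ n X (legIndex x) (sideIndex {n} x) (subst (_∈ X) (sym (combine-remQuot {n} 2 x)) x∈X)))

module Construction (n : ℕ) (𝒯 : Vec Bool n → Bool) where

  inFamily : Subset (n * 2) → Bool
  inFamily X = maybe 𝒯 false (asTransversal n X)

  freeRank∞ : Bool → Subset (n * 2) → ℕ
  freeRank∞ t X = legCount n X + ⟦ t ∨ hasFullLeg n X ⟧

  freeRank : Bool → Subset (n * 2) → ℕ
  freeRank t X = freeRank∞ t X ⊓ n

  lowered : Bool → Subset (n * 2) → Bool
  lowered t X = not t ∧ inFamily X

  -- The rank function of N: freeRank is that of the free spike, and lowered picks out the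
  -- transversals in 𝒯, which become circuit-hyperplanes.
  ρ : Subset (suc (n * 2)) → ℕ
  ρ (t ∷ X) = freeRank t X ∸ ⟦ lowered t X ⟧

  freeRank∞-∩ : ∀ t₁ t₂ X Y → freeRank∞ (t₁ ∧ t₂) (X ∩ Y) ≤ freeRank∞ t₂ Y
  freeRank∞-∩ t₁ t₂ X Y =
    proj₂ (+-∨-mono-≼ {0} {t₁ ∧ t₂} {0} {t₂} (z≤n , ⟦∧⟧≤⟦⟧ t₁ t₂) (legCount-∩ n X Y))

  freeRank∞-∩ˡ : ∀ t₁ t₂ X Y → freeRank∞ (t₁ ∧ t₂) (X ∩ Y) ≤ freeRank∞ t₁ X
  freeRank∞-∩ˡ t₁ t₂ X Y rewrite ∩-comm X Y | ∧-comm t₁ t₂ = freeRank∞-∩ t₂ t₁ Y X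

  freeRank-∩ : ∀ t₁ t₂ X Y → freeRank (t₁ ∧ t₂) (X ∩ Y) ≤ freeRank t₂ Y
  freeRank-∩ t₁ t₂ X Y = ⊓-monoˡ-≤ n (freeRank∞-∩ t₁ t₂ X Y)

  freeRank∞-submodular : ∀ t₁ t₂ X Y →
    freeRank∞ (t₁ ∨ t₂) (X ∪ Y) + freeRank∞ (t₁ ∧ t₂) (X ∩ Y) ≤ freeRank∞ t₁ X + freeRank∞ t₂ Y
  freeRank∞-submodular t₁ t₂ X Y = begin
    (a∪ + ⟦ u ⟧) + (a∩ + ⟦ i ⟧)   ≡⟨ interchange a∪ ⟦ u ⟧ a∩ ⟦ i ⟧ ⟩
    (a∪ + a∩) + (⟦ u ⟧ + ⟦ i ⟧)   ≡⟨ +-assoc (a∪ + a∩) ⟦ u ⟧ ⟦ i ⟧ ⟨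
    a∪ + a∩ + ⟦ u ⟧ + ⟦ i ⟧       ≤⟨ +-monoˡ-≤ ⟦ i ⟧ (proj₂ tipped) ⟩
    aX + aY + ⟦ p ∨ q ⟧ + ⟦ i ⟧   ≡⟨ +-assoc (aX + aY) ⟦ p ∨ q ⟧ ⟦ i ⟧ ⟩
    aX + aY + (⟦ p ∨ q ⟧ + ⟦ i ⟧) ≤⟨ +-monoʳ-≤ (aX + aY) (⟦∨⟧+⟦⟧≤⟦⟧+⟦⟧ p q i (∧∨⇒∨∧ t₁ t₂ i⇒x i⇒y)) ⟩
    aX + aY + (⟦ p ⟧ + ⟦ q ⟧)     ≡⟨ interchange aX aY ⟦ p ⟧ ⟦ q ⟧ ⟩
    (aX + ⟦ p ⟧) + (aY + ⟦ q ⟧)   ∎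
    where
    open ≤-Reasoning
    a∪ = legCount n (X ∪ Y)
    a∩ = legCount n (X ∩ Y)
    aX = legCount n X
    aY = legCount n Y
    u = (t₁ ∨ t₂) ∨ hasFullLeg n (X ∪ Y)
    i = (t₁ ∧ t₂) ∨ hasFullLeg n (X ∩ Y)
    p = t₁ ∨ hasFullLeg n X
    q = t₂ ∨ hasFullLeg n Y
    i⇒x : hasFullLeg n (X ∩ Y) ≡ true → hasFullLeg n X ≡ true
    i⇒x = hasFullLeg-mono n (p∩q⊆p X Y)
    i⇒y : hasFullLeg n (X ∩ Y) ≡ true → hasFullLeg n Y ≡ true
    i⇒y = hasFullLeg-mono n (p∩q⊆q X Y)
    tipped : (a∪ + a∩ , u) ≼ (aX + aY , p ∨ q)
    tipped = ≼-cong refl refl refl (∨-interchange t₁ t₂ _ _)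
                    (+-∨-mono-≼ {0} {t₁ ∨ t₂} {0} {t₁ ∨ t₂} (≤-refl , ≤-refl) (legCount-∪∩ n X Y))

  freeRank-submodular : ∀ t₁ t₂ X Y →
    freeRank (t₁ ∨ t₂) (X ∪ Y) + freeRank (t₁ ∧ t₂) (X ∩ Y) ≤ freeRank t₁ X + freeRank t₂ Y
  freeRank-submodular t₁ t₂ X Y =
    +-⊓-mono n (freeRank∞-submodular t₁ t₂ X Y) (freeRank∞-∩ˡ t₁ t₂ X Y) (freeRank∞-∩ t₁ t₂ X Y)

  ρ≤freeRank : ∀ t X → ρ (t ∷ X) ≤ freeRank t X
  ρ≤freeRank t X = m∸n≤m (freeRank t X) ⟦ lowered t X ⟧

  ρ-unlowered : ∀ t X → lowered t X ≡ false → ρ (t ∷ X) ≡ freeRank t X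
  ρ-unlowered t X e rewrite e = refl

  inFamily-transSet : ∀ v → inFamily (transSet v) ≡ 𝒯 v
  inFamily-transSet v rewrite asTransversal-transSet n v = refl

  inFamily⇒transSet : ∀ X → inFamily X ≡ true → Σ (Vec Bool n) λ v → X ≡ transSet v × 𝒯 v ≡ true
  inFamily⇒transSet X e with asTransversal n X in eq
  ... | just v = v , asTransversal-sound n X eq , e

  freeRank-transSet : ∀ v → freeRank false (transSet v) ≡ n
  freeRank-transSet v rewrite legCount-transSet n v | hasFullLeg-transSet n v = m≥n⇒m⊓n≡n (m≤m+n n 0)

  ρ-transSet : ∀ v → ρ (false ∷ transSet v) ≡ n ∸ ⟦ 𝒯 v ⟧
  ρ-transSet v rewrite freeRank-transSet v | inFamily-transSet v = refl

  ρ-inFamily : ∀ {v} → 𝒯 v ≡ true → ρ (false ∷ transSet v) ≡ n ∸ 1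
  ρ-inFamily {v} 𝒯v = trans (ρ-transSet v) (cong (λ b → n ∸ ⟦ b ⟧) 𝒯v)

  ρ-transSet∩≤legCount : ∀ v Y → ρ (false ∷ (transSet v ∩ Y)) ≤ legCount n (transSet v ∩ Y)
  ρ-transSet∩≤legCount v Y = begin
    ρ (false ∷ (transSet v ∩ Y))                  ≤⟨ ρ≤freeRank false (transSet v ∩ Y) ⟩
    freeRank false (transSet v ∩ Y)               ≤⟨ m⊓n≤m _ n ⟩
    legCount n (transSet v ∩ Y) + ⟦ hasFullLeg n (transSet v ∩ Y) ⟧
      ≡⟨ cong (λ b → legCount n (transSet v ∩ Y) + ⟦ b ⟧) (hasFullLeg-transSet∩ n v Y) ⟩
    legCount n (transSet v ∩ Y) + 0               ≡⟨ +-identityʳ _ ⟩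
    legCount n (transSet v ∩ Y)                   ∎
    where open ≤-Reasoning

  transSet∩<freeRank : 1 ≤ n → ∀ {v} t Y → 𝒯 v ≡ true → lowered t (transSet v ∪ Y) ≡ false →
                       ρ (false ∷ (transSet v ∩ Y)) < freeRank t Y
  transSet∩<freeRank 1≤n {v} t Y 𝒯v unlowered with transSet v ⊈ᵇ Y in T⊈Y
  ... | false = begin-strict
      ρ (false ∷ (T ∩ Y))    ≡⟨ cong (λ Z → ρ (false ∷ Z)) T∩Y≡T ⟩
      ρ (false ∷ T)          ≡⟨ ρ-inFamily 𝒯v ⟩
      n ∸ 1                  <⟨ ∸-monoʳ-< (s≤s z≤n) 1≤n ⟩
      n                      ≡⟨ freeRank-transSet v ⟨
      freeRank false T       ≡⟨ cong (freeRank false) T∩Y≡T ⟨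
      freeRank false (T ∩ Y) ≤⟨ freeRank-∩ false t T Y ⟩
      freeRank t Y           ∎
    where
    open ≤-Reasoning
    T = transSet v
    T∩Y≡T : T ∩ Y ≡ T
    T∩Y≡T = ⊆⇒∩≡ (⊈ᵇ≡false⇒⊆ T Y T⊈Y)
  ... | true = ≤-trans (s≤s (ρ-transSet∩≤legCount v Y)) (⊓-glb (below-freeRank∞ t unlowered) below-n)
    where
    T = transSet v
    below-n : legCount n (T ∩ Y) < n
    below-n = transversal⊈⇒legCount∩<n n v Y T⊈Y
    below-freeRank∞ : ∀ t → lowered t (T ∪ Y) ≡ false → legCount n (T ∩ Y) < freeRank∞ t Y
    below-freeRank∞ true  _   =
      subst (suc (legCount n (T ∩ Y)) ≤_) (+-comm 1 _) (s≤s (proj₁ (legCount-∩ n T Y)))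
    below-freeRank∞ false unl with Y ⊈ᵇ T in Y⊈T
    ... | true  = ≼⇒< Y⊈T (transversal∩≼legCount n v Y)
    ... | false = contradiction (trans (sym unl) T∪Y∈𝒯) λ ()
      where
      T∪Y∈𝒯 : inFamily (T ∪ Y) ≡ true
      T∪Y∈𝒯 = trans (cong inFamily (⊆⇒∪≡ (⊈ᵇ≡false⇒⊆ Y T Y⊈T))) (trans (inFamily-transSet v) 𝒯v)

  Separated : Set
  Separated = ∀ T₁ T₂ → 𝒯 T₁ ≡ true → 𝒯 T₂ ≡ true → ∣ transSet T₁ ─ transSet T₂ ∣ ≢ 1

  transSet∩transSet<n∸1 : Separated → ∀ {v w} → 𝒯 v ≡ true → 𝒯 w ≡ true →
                          inFamily (transSet v ∪ transSet w) ≡ false →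
                          ρ (false ∷ (transSet v ∩ transSet w)) < n ∸ 1
  transSet∩transSet<n∸1 sep {v} {w} 𝒯v 𝒯w notInFamily =
    ≤-trans (s≤s (ρ-transSet∩≤legCount v (transSet w)))
            (+≡⇒<∸1 (∣─∣+legCount∩≡n n v w) v≢w (sep v w 𝒯v 𝒯w))
    where
    v≢w : ∣ transSet v ─ transSet w ∣ ≢ 0
    v≢w e with ∣─∣≡0⇒≡ n v w e
    ... | refl = contradiction (trans (sym notInFamily) T∪T∈𝒯) λ ()
      where
      T∪T∈𝒯 : inFamily (transSet v ∪ transSet v) ≡ true
      T∪T∈𝒯 = trans (cong inFamily (∪-idem (transSet v))) (trans (inFamily-transSet v) 𝒯v)

  transSet∩<ρ : Separated → 1 ≤ n → ∀ {v} t Y → 𝒯 v ≡ true → lowered t (transSet v ∪ Y) ≡ false →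
                ρ (false ∷ (transSet v ∩ Y)) < ρ (t ∷ Y)
  transSet∩<ρ sep 1≤n {v} t Y 𝒯v unlowered with lowered t Y in lowY
  ... | false = transSet∩<freeRank 1≤n t Y 𝒯v unlowered
  ... | true  = below-circuitHyperplane t Y lowY unlowered
    where
    below-circuitHyperplane : ∀ t Y → lowered t Y ≡ true → lowered t (transSet v ∪ Y) ≡ false →
                              ρ (false ∷ (transSet v ∩ Y)) < freeRank t Y ∸ 1
    below-circuitHyperplane false Y Y∈𝒯 T∪Y∉𝒯 with inFamily⇒transSet Y Y∈𝒯
    ... | w , refl , 𝒯w rewrite freeRank-transSet w = transSet∩transSet<n∸1 sep 𝒯v 𝒯w T∪Y∉𝒯

  transSet∪≡transSet : ∀ v Y → inFamily (transSet v ∪ Y) ≡ true → transSet v ∪ Y ≡ transSet v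
  transSet∪≡transSet v Y e with inFamily⇒transSet (transSet v ∪ Y) e
  ... | w , T∪Y≡W , _ with transSet-⊆⇒≡ n v w (subst (transSet v ⊆_) T∪Y≡W (p⊆p∪q Y))
  ... | refl = T∪Y≡W

  ρ-submodular-transSet : Separated → 1 ≤ n → ∀ {v} t Y → 𝒯 v ≡ true →
    ρ (t ∷ (transSet v ∪ Y)) + ρ (false ∷ (transSet v ∩ Y)) ≤ ρ (false ∷ transSet v) + ρ (t ∷ Y)
  ρ-submodular-transSet sep 1≤n {v} t Y 𝒯v with lowered t (transSet v ∪ Y) in low
  ... | false = subst (λ r → freeRank t (T ∪ Y) + ρ (false ∷ (T ∩ Y)) ≤ r + ρ (t ∷ Y))
                      (sym (ρ-inFamily 𝒯v))
                      (+-≤-∸1 1≤n (m⊓n≤n _ n) (transSet∩<ρ sep 1≤n t Y 𝒯v low))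
    where T = transSet v
  ... | true  = absorbed t low
    where
    T = transSet v
    absorbed : ∀ t → lowered t (T ∪ Y) ≡ true →
               freeRank t (T ∪ Y) ∸ 1 + ρ (false ∷ (T ∩ Y)) ≤ ρ (false ∷ T) + ρ (t ∷ Y)
    absorbed false T∪Y∈𝒯 = ≤-reflexive (cong₂ _+_ ∪-part ∩-part)
      where
      T∪Y≡T = transSet∪≡transSet v Y T∪Y∈𝒯
      ∪-part : freeRank false (T ∪ Y) ∸ 1 ≡ ρ (false ∷ T)
      ∪-part = begin
        freeRank false (T ∪ Y) ∸ 1 ≡⟨ cong (λ Z → freeRank false Z ∸ 1) T∪Y≡T ⟩
        freeRank false T ∸ 1       ≡⟨ cong (_∸ 1) (freeRank-transSet v) ⟩
        n ∸ 1                      ≡⟨ ρ-inFamily 𝒯v ⟨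
        ρ (false ∷ T)              ∎
        where open ≡-Reasoning
      ∩-part : ρ (false ∷ (T ∩ Y)) ≡ ρ (false ∷ Y)
      ∩-part = cong (λ Z → ρ (false ∷ Z)) (∪≡⇒∩≡ T Y T∪Y≡T)

  ρ-submodular-lowered : Separated → 1 ≤ n → ∀ t₁ X t₂ Y → lowered t₁ X ≡ true →
    ρ ((t₁ ∷ X) ∪ (t₂ ∷ Y)) + ρ ((t₁ ∷ X) ∩ (t₂ ∷ Y)) ≤ ρ (t₁ ∷ X) + ρ (t₂ ∷ Y)
  ρ-submodular-lowered sep 1≤n false X t₂ Y X∈𝒯 with inFamily⇒transSet X X∈𝒯
  ... | v , refl , 𝒯v = ρ-submodular-transSet sep 1≤n t₂ Y 𝒯v

  ρ-submodular : Separated → 1 ≤ n → ∀ X Y → ρ (X ∪ Y) + ρ (X ∩ Y) ≤ ρ X + ρ Y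
  ρ-submodular sep 1≤n X′@(t₁ ∷ X) Y′@(t₂ ∷ Y) =
    Bool-cases (lowered t₁ X) (ρ-submodular-lowered sep 1≤n t₁ X t₂ Y) λ low₁ →
    Bool-cases (lowered t₂ Y) (swapped ∘ ρ-submodular-lowered sep 1≤n t₂ Y t₁ X) λ low₂ → begin
      ρ (X′ ∪ Y′) + ρ (X′ ∩ Y′)                          ≤⟨ +-mono-≤ (ρ≤freeRank _ _) (ρ≤freeRank _ _) ⟩
      freeRank (t₁ ∨ t₂) (X ∪ Y) + freeRank (t₁ ∧ t₂) (X ∩ Y) ≤⟨ freeRank-submodular t₁ t₂ X Y ⟩
      freeRank t₁ X + freeRank t₂ Y
        ≡⟨ cong₂ _+_ (ρ-unlowered t₁ X low₁) (ρ-unlowered t₂ Y low₂) ⟨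
      ρ X′ + ρ Y′                                        ∎
    where
    open ≤-Reasoning
    swapped : ρ (Y′ ∪ X′) + ρ (Y′ ∩ X′) ≤ ρ Y′ + ρ X′ → ρ (X′ ∪ Y′) + ρ (X′ ∩ Y′) ≤ ρ X′ + ρ Y′
    swapped = subst₂ _≤_ (cong₂ _+_ (cong ρ (∪-comm Y′ X′)) (cong ρ (∩-comm Y′ X′)))
                         (+-comm (ρ Y′) (ρ X′))

  ρ-∩transSet≤n∸1 : ∀ {u} X → 𝒯 u ≡ true → ρ (false ∷ (X ∩ transSet u)) ≤ n ∸ 1
  ρ-∩transSet≤n∸1 {u} X 𝒯u with transSet u ⊈ᵇ X in U⊈X
  ... | false = ≤-reflexive (trans (cong (λ Z → ρ (false ∷ Z)) X∩U≡U) (ρ-inFamily 𝒯u))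
    where
    X∩U≡U : X ∩ transSet u ≡ transSet u
    X∩U≡U = trans (∩-comm X (transSet u)) (⊆⇒∩≡ (⊈ᵇ≡false⇒⊆ (transSet u) X U⊈X))
  ... | true  = subst (λ Z → ρ (false ∷ Z) ≤ n ∸ 1) (∩-comm (transSet u) X)
                  (≤-trans (ρ-transSet∩≤legCount u X) (<⇒≤∸1 (transversal⊈⇒legCount∩<n n u X U⊈X)))

  ρ-∩ : ∀ X Y → ρ (X ∩ Y) ≤ ρ Y
  ρ-∩ X′@(t₁ ∷ X) (t₂ ∷ Y) =
    Bool-cases (lowered t₂ Y) (lowered-case t₁ t₂ Y) λ low₂ →
      subst (ρ (X′ ∩ (t₂ ∷ Y)) ≤_) (sym (ρ-unlowered t₂ Y low₂))
            (≤-trans (ρ≤freeRank (t₁ ∧ t₂) (X ∩ Y)) (freeRank-∩ t₁ t₂ X Y))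
    where
    lowered-case : ∀ t₁ t₂ Y → lowered t₂ Y ≡ true → ρ ((t₁ ∷ X) ∩ (t₂ ∷ Y)) ≤ ρ (t₂ ∷ Y)
    lowered-case t₁ false Y Y∈𝒯 with inFamily⇒transSet Y Y∈𝒯
    ... | u , refl , 𝒯u = subst (λ b → ρ (b ∷ (X ∩ transSet u)) ≤ ρ (false ∷ transSet u))
                                (sym (∧-zeroʳ t₁))
                            (≤-trans (ρ-∩transSet≤n∸1 X 𝒯u) (≤-reflexive (sym (ρ-inFamily 𝒯u))))

  ρ-mono : ∀ X Y → X ⊆ Y → ρ X ≤ ρ Y
  ρ-mono X Y X⊆Y = subst (_≤ ρ Y) (cong ρ (⊆⇒∩≡ X⊆Y)) (ρ-∩ X Y)

  ρ≤∣∣ : ∀ X → ρ X ≤ ∣ X ∣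
  ρ≤∣∣ (t ∷ X) = begin
    ρ (t ∷ X)                               ≤⟨ ρ≤freeRank t X ⟩
    freeRank t X                            ≤⟨ m⊓n≤m _ n ⟩
    legCount n X + ⟦ t ∨ hasFullLeg n X ⟧   ≤⟨ +-monoʳ-≤ (legCount n X) (⟦∨⟧≤⟦⟧+⟦⟧ t (hasFullLeg n X)) ⟩
    legCount n X + (⟦ t ⟧ + ⟦ hasFullLeg n X ⟧) ≡⟨ x∙yz≈y∙xz (legCount n X) ⟦ t ⟧ _ ⟩
    ⟦ t ⟧ + (legCount n X + ⟦ hasFullLeg n X ⟧)
      ≤⟨ +-monoʳ-≤ ⟦ t ⟧ (≤-trans (proj₂ (legCount≼∣∣ n X)) (≤-reflexive (+-identityʳ _))) ⟩
    ⟦ t ⟧ + ∣ X ∣                           ≡⟨ ∣x∷p∣≡⟦x⟧+∣p∣ t X ⟨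
    ∣ t ∷ X ∣                               ∎
    where open ≤-Reasoning

  N : Separated → 1 ≤ n → Matroid (suc (n * 2))
  N sep 1≤n = record
    { rank = ρ ; rank-≤ = ρ≤∣∣ ; rank-mono = ρ-mono ; rank-sub = ρ-submodular sep 1≤n }

  M : Separated → 1 ≤ n → Matroid (n * 2)
  M sep 1≤n = record
    { rank      = λ X → ρ (false ∷ X)
    ; rank-≤    = λ X → ρ≤∣∣ (false ∷ X)
    ; rank-mono = λ X Y X⊆Y → ρ-mono (false ∷ X) (false ∷ Y) (s⊆s X⊆Y)
    ; rank-sub  = λ X Y → ρ-submodular sep 1≤n (false ∷ X) (false ∷ Y)
    }

  freeRank∞-small : ∀ d X → ⟦ d ⟧ + ∣ X ∣ ≤ 2 → freeRank∞ d X ≡ ⟦ d ⟧ + ∣ X ∣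
  freeRank∞-small d X small with hasFullLeg n X in hf
  ... | false = begin
    legCount n X + ⟦ d ∨ false ⟧              ≡⟨ cong (λ b → legCount n X + ⟦ b ⟧) (∨-identityʳ d) ⟩
    legCount n X + ⟦ d ⟧                      ≡⟨ +-comm (legCount n X) ⟦ d ⟧ ⟩
    ⟦ d ⟧ + legCount n X                      ≡⟨ cong (⟦ d ⟧ +_) (+-identityʳ _) ⟨
    ⟦ d ⟧ + (legCount n X + 0)
      ≡⟨ cong (λ k → ⟦ d ⟧ + (legCount n X + k)) (¬hasFullLeg⇒fullLegCount≡0 n X hf) ⟨
    ⟦ d ⟧ + (legCount n X + fullLegCount n X) ≡⟨ cong (⟦ d ⟧ +_) (∣∣≡legCount+fullLegCount n X) ⟨
    ⟦ d ⟧ + ∣ X ∣                             ∎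
    where open ≡-Reasoning
  ... | true  = begin
    legCount n X + ⟦ d ∨ true ⟧
      ≡⟨ one-leg d _ _ (hasFullLeg⇒1≤fullLegCount n X hf) (fullLegCount≤legCount n X)
                       (subst (λ k → ⟦ d ⟧ + k ≤ 2) ∣X∣≡ small) ⟩
    ⟦ d ⟧ + (legCount n X + fullLegCount n X) ≡⟨ cong (⟦ d ⟧ +_) ∣X∣≡ ⟨
    ⟦ d ⟧ + ∣ X ∣                             ∎
    where
    open ≡-Reasoning
    ∣X∣≡ = ∣∣≡legCount+fullLegCount n X
    one-leg : ∀ t l f → 1 ≤ f → f ≤ l → ⟦ t ⟧ + (l + f) ≤ 2 → l + ⟦ t ∨ true ⟧ ≡ ⟦ t ⟧ + (l + f)
    one-leg false (suc l) (suc zero)    _ _   _                = refl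
    one-leg false (suc l) (suc (suc f)) _ _   (s≤s l+f≤1)       with s≤s () ← m+n≤o⇒n≤o l l+f≤1
    one-leg true  (suc l) (suc f)       _ _   (s≤s (s≤s l+f≤0)) with () ← m+n≤o⇒n≤o l l+f≤0

  ρ-small : 3 ≤ n → ∀ D → ∣ D ∣ ≤ 2 → ρ D ≡ ∣ D ∣
  ρ-small 3≤n (d ∷ X) ∣D∣≤2 =
    Bool-cases (lowered d X) (λ low → contradiction low (unlowered d X small≤2)) λ unlow → begin
    ρ (d ∷ X)       ≡⟨ ρ-unlowered d X unlow ⟩
    freeRank d X    ≡⟨ m≤n⇒m⊓n≡m (≤-trans (≤-reflexive small) (≤-trans small≤2 (≤-trans (n≤1+n 2) 3≤n))) ⟩
    freeRank∞ d X   ≡⟨ small ⟩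
    ⟦ d ⟧ + ∣ X ∣   ≡⟨ ∣x∷p∣≡⟦x⟧+∣p∣ d X ⟨
    ∣ d ∷ X ∣       ∎
    where
    open ≡-Reasoning
    small≤2 : ⟦ d ⟧ + ∣ X ∣ ≤ 2
    small≤2 = subst (_≤ 2) (∣x∷p∣≡⟦x⟧+∣p∣ d X) ∣D∣≤2
    small : freeRank∞ d X ≡ ⟦ d ⟧ + ∣ X ∣
    small = freeRank∞-small d X small≤2
    unlowered : ∀ d X → ⟦ d ⟧ + ∣ X ∣ ≤ 2 → lowered d X ≢ true
    unlowered false X ∣X∣≤2 X∈𝒯 with inFamily⇒transSet X X∈𝒯
    ... | v , refl , _ = <⇒≱ (≤-trans (s≤s ∣X∣≤2) 3≤n) (≤-reflexive (sym (∣transSet∣ n v)))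

  ρ-⊤ : ρ ⊤ ≡ n
  ρ-⊤ = trans (cong (λ k → (k + 1) ⊓ n) (legCount-⊤ n)) (m≥n⇒m⊓n≡n (m≤m+n n 1))

  ρ-legs : 1 ≤ n → ∀ (J : Subset n) → Nonempty J → J ≢ ⊤ → ρ (false ∷ legsSet J) ≡ ∣ J ∣ + 1
  ρ-legs 1≤n J (i , i∈J) J≢⊤
    rewrite asTransversal-legsSet n 1≤n J | legCount-legsSet n J
          | sides⇒hasFullLeg n (legsSet J) i (λ s → ∈legsSet⁺ s i∈J) = m≤n⇒m⊓n≡m ∣J∣<n
    where
    ∣J∣<n : ∣ J ∣ + 1 ≤ n
    ∣J∣<n = subst (_≤ n) (+-comm 1 ∣ J ∣) (≤∧≢⇒< (∣p∣≤n J) (J≢⊤ ∘ ∣p∣≡n⇒p≡⊤))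

  tip-leg-circuit : ∀ sep 1≤n → 3 ≤ n → ∀ i → Circuit (N sep 1≤n) (true ∷ legsSet ⁅ i ⁆)
  tip-leg-circuit sep 1≤n 3≤n i = dependent , independent
    where
    dependent : ρ (true ∷ legsSet ⁅ i ⁆) < ∣ true ∷ legsSet ⁅ i ⁆ ∣
    dependent = s≤s (≤-trans (m⊓n≤m _ n) (≤-reflexive (begin
      legCount n (legsSet ⁅ i ⁆) + 1 ≡⟨ cong (_+ 1) (trans (legCount-legsSet n ⁅ i ⁆) (∣⁅x⁆∣≡1 i)) ⟩
      2                              ≡⟨ ∣leg∣≡2 i ⟨
      ∣ legsSet ⁅ i ⁆ ∣              ∎)))
      where open ≡-Reasoning
    independent : ∀ D → D ⊂ (true ∷ legsSet ⁅ i ⁆) → ρ D ≡ ∣ D ∣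
    independent D D⊂C =
      ρ-small 3≤n D (≤-pred (≤-trans (p⊂q⇒∣p∣<∣q∣ D⊂C) (≤-reflexive (cong suc (∣leg∣≡2 i)))))

  dependent⇔ : 1 ≤ n → ∀ v → (ρ (false ∷ transSet v) < ∣ transSet v ∣) ⇔ (𝒯 v ≡ true)
  dependent⇔ 1≤n v rewrite ρ-transSet v | ∣transSet∣ n v = mk⇔ (to (𝒯 v)) (from (𝒯 v))
    where
    to : ∀ b → n ∸ ⟦ b ⟧ < n → b ≡ true
    to true  _   = refl
    to false n<n = contradiction n<n (<-irrefl refl)
    from : ∀ b → b ≡ true → n ∸ ⟦ b ⟧ < n
    from true _ = ∸-monoʳ-< (s≤s z≤n) 1≤n

module Closure {m} (N : Matroid m) where

  r : Subset m → ℕ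
  r = rank N

  Spans : Subset m → Subset m → Set
  Spans A W = r (A ∪ W) ≤ r A

  Spans-⊆ : ∀ {A W} → W ⊆ A → Spans A W
  Spans-⊆ {A} {W} W⊆A = rank-mono N (A ∪ W) A (∪-⊆ id W⊆A)

  Spans-antimono : ∀ {A W W′} → W ⊆ W′ → Spans A W′ → Spans A W
  Spans-antimono {A} {W} {W′} W⊆W′ = ≤-trans (rank-mono N _ _ (∪-⊆ (p⊆p∪q W′) (q⊆p∪q A W′ ∘ W⊆W′)))

  Spans-mono : ∀ {A B W} → B ⊆ A → Spans B W → Spans A W
  Spans-mono {A} {B} {W} B⊆A B-spans = +-cancelʳ-≤ (r B) _ _ (begin
    r (A ∪ W) + r B
      ≤⟨ +-mono-≤ (rank-mono N _ _ (∪-⊆ (p⊆p∪q _) (q⊆p∪q A _ ∘ q⊆p∪q B W)))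
                  (rank-mono N B _ (λ x∈B → x∈p∩q⁺ (B⊆A x∈B , p⊆p∪q W x∈B))) ⟩
    r (A ∪ (B ∪ W)) + r (A ∩ (B ∪ W))   ≤⟨ rank-sub N A (B ∪ W) ⟩
    r A + r (B ∪ W)                     ≤⟨ +-monoʳ-≤ (r A) B-spans ⟩
    r A + r B                           ∎)
    where open ≤-Reasoning

  Spans-∪ : ∀ {A W W′} → Spans A W → Spans A W′ → Spans A (W ∪ W′)
  Spans-∪ {A} {W} {W′} spans spans′ = begin
    r (A ∪ (W ∪ W′)) ≡⟨ cong r (∪-assoc A W W′) ⟨
    r ((A ∪ W) ∪ W′) ≤⟨ Spans-mono {A ∪ W} {A} {W′} (p⊆p∪q W) spans′ ⟩
    r (A ∪ W)        ≤⟨ spans ⟩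
    r A              ∎
    where open ≤-Reasoning

  Spans-elements : ∀ A Z → (∀ {e} → e ∈ Z → Spans A ⁅ e ⁆) → Spans A Z
  Spans-elements A = All.wfRec ⊂-wellFounded 0ℓ SpansElements step
    where
    SpansElements : Subset m → Set
    SpansElements Z = (∀ {e} → e ∈ Z → Spans A ⁅ e ⁆) → Spans A Z
    step : ∀ Z → (∀ {Z′} → Z′ ⊂ Z → SpansElements Z′) → SpansElements Z
    step Z rec each with nonempty? Z
    ... | no  Z-empty rewrite Empty-unique Z-empty = Spans-⊆ (⊆-min A)
    ... | yes (x , x∈Z) = Spans-antimono Z⊆Z-x∪x
                            (Spans-∪ (rec (x∈p⇒p-x⊂p x∈Z) (each ∘ p─q⊆p Z ⁅ x ⁆)) (each x∈Z))
      where
      Z⊆Z-x∪x : Z ⊆ (Z - x) ∪ ⁅ x ⁆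
      Z⊆Z-x∪x {y} y∈Z with y Fin.≟ x
      ... | yes refl = q⊆p∪q (Z - x) ⁅ x ⁆ (x∈⁅x⁆ x)
      ... | no  y≢x  = p⊆p∪q ⁅ x ⁆ (x∈p∧x≢y⇒x∈p-y y∈Z y≢x)

  rank-∪⁅⁆ : ∀ A e → r (A ∪ ⁅ e ⁆) ≤ r A + 1
  rank-∪⁅⁆ A e = ≤-trans (m≤m+n _ _) (≤-trans (rank-sub N A ⁅ e ⁆)
                   (+-monoʳ-≤ (r A) (≤-trans (rank-≤ N ⁅ e ⁆) (≤-reflexive (∣⁅x⁆∣≡1 e)))))

module Uniqueness (n : ℕ) (𝒯 : Vec Bool n → Bool) (3≤n : 3 ≤ n) (N : Matroid (suc (n * 2)))
  (rank-⊤ : rank N ⊤ ≡ n)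
  (tip-leg-circuit : ∀ (i : Fin n) → Circuit N (true ∷ legsSet ⁅ i ⁆))
  (rank-legs : ∀ (J : Subset n) → Nonempty J → J ≢ ⊤ → rank N (false ∷ legsSet J) ≡ ∣ J ∣ + 1)
  (dependent⇔ : ∀ v → rank N (false ∷ transSet v) < n ⇔ 𝒯 v ≡ true)
  where

  open Closure N
  open Construction n 𝒯 using (ρ; freeRank; freeRank-transSet)

  rank-tip-leg≤2 : ∀ (i : Fin n) → r (true ∷ legsSet ⁅ i ⁆) ≤ 2
  rank-tip-leg≤2 i =
    ≤-pred (subst (r (true ∷ legsSet ⁅ i ⁆) <_) (cong suc (∣leg∣≡2 i)) (proj₁ (tip-leg-circuit i)))

  tip-side-spans-other : ∀ (i : Fin n) s →
                         Spans (true ∷ ⁅ legElem i (otherSide s) ⁆) ⁅ suc (legElem i s) ⁆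
  tip-side-spans-other i s = begin
    r (A ∪ ⁅ suc (legElem i s) ⁆) ≤⟨ rank-mono N _ _ (∪-⊆ A⊆C (⁅⁆⊆ (there (∈legsSet⁺ s (x∈⁅x⁆ i))))) ⟩
    r (true ∷ legsSet ⁅ i ⁆)      ≤⟨ rank-tip-leg≤2 i ⟩
    2                             ≡⟨ rA ⟨
    r A                           ∎
    where
    open ≤-Reasoning
    A = true ∷ ⁅ legElem i (otherSide s) ⁆
    A⊆C : A ⊆ true ∷ legsSet ⁅ i ⁆
    A⊆C = in⊆in (⁅⁆⊆ (∈legsSet⁺ (otherSide s) (x∈⁅x⁆ i)))
    s∉A : suc (legElem i s) ∉ A
    s∉A s∈A = otherSide≢ s (combine-injectiveʳ i s i (otherSide s) (x∈⁅y⁆⇒x≡y _ (drop-there s∈A)))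
    rA : r A ≡ 2
    rA = trans (proj₂ (tip-leg-circuit i) A (A⊆C , _ , there (∈legsSet⁺ s (x∈⁅x⁆ i)) , s∉A))
               (cong suc (∣⁅x⁆∣≡1 (legElem {n} i (otherSide s))))

  leg-spans-tip : ∀ (i : Fin n) → Spans (false ∷ legsSet ⁅ i ⁆) ⁅ zero ⁆
  leg-spans-tip i = begin
    r ((false ∷ legsSet ⁅ i ⁆) ∪ ⁅ zero ⁆) ≤⟨ rank-mono N _ _ (∪-⊆ (out⊆ id) (⁅⁆⊆ here)) ⟩
    r (true ∷ legsSet ⁅ i ⁆)               ≤⟨ rank-tip-leg≤2 i ⟩
    2                                      ≡⟨ trans (proj₂ (tip-leg-circuit i) _ (out⊆ id , zero , here , λ ()))
                                                    (∣leg∣≡2 i) ⟨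
    r (false ∷ legsSet ⁅ i ⁆)              ∎
    where open ≤-Reasoning

  tip⊆ : ∀ (X : Subset (n * 2)) → true ∷ X ⊆ (false ∷ X) ∪ ⁅ zero ⁆
  tip⊆ X here      = here
  tip⊆ X (there p) = there (p⊆p∪q ⊥ p)

  rank-tip-full-leg : ∀ X (i : Fin n) → legsSet ⁅ i ⁆ ⊆ X → r (true ∷ X) ≡ r (false ∷ X)
  rank-tip-full-leg X i leg⊆X = ≤-antisym
    (≤-trans (rank-mono N _ _ (tip⊆ X)) (Spans-mono (out⊆ leg⊆X) (leg-spans-tip i)))
    (rank-mono N _ _ (out⊆ id))

  rank-tip≤rank+1 : ∀ X → r (true ∷ X) ≤ r (false ∷ X) + 1
  rank-tip≤rank+1 X = ≤-trans (rank-mono N _ _ (tip⊆ X)) (rank-∪⁅⁆ (false ∷ X) zero)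

  tip-spans-met-leg : ∀ X (i : Fin n) s → i ∈ legsMet n X → Spans (true ∷ X) ⁅ suc (legElem i s) ⁆
  tip-spans-met-leg X i s i∈met with ∈legsMet⁻ n X i i∈met s
  ... | inj₁ s∈X = Spans-⊆ (⁅⁆⊆ (there s∈X))
  ... | inj₂ o∈X = Spans-mono {W = ⁅ suc (legElem i s) ⁆} (in⊆in (⁅⁆⊆ o∈X)) (tip-side-spans-other i s)

  tip-spans-legsMet : ∀ X → Spans (true ∷ X) (true ∷ legsSet (legsMet n X))
  tip-spans-legsMet X = Spans-elements (true ∷ X) _ spans
    where
    spans : ∀ {e} → e ∈ true ∷ legsSet (legsMet n X) → Spans (true ∷ X) ⁅ e ⁆
    spans here = Spans-⊆ (⁅⁆⊆ here)
    spans {suc x} (there x∈legs) =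
      subst (λ y → Spans (true ∷ X) ⁅ suc y ⁆) (combine-remQuot {n} 2 x)
            (tip-spans-met-leg X (legIndex {n} x) (sideIndex {n} x) (∈legsSet⁻ {n} x∈legs))

  rank-tip-legsMet : ∀ X → r (true ∷ X) ≡ r (true ∷ legsSet (legsMet n X))
  rank-tip-legsMet X = ≤-antisym
    (rank-mono N _ _ (in⊆in (⊆legsSet-legsMet n X)))
    (≤-trans (rank-mono N _ _ (q⊆p∪q (true ∷ X) _)) (tip-spans-legsMet X))

  rank-tip-legs : ∀ (J : Subset n) → Nonempty J → r (true ∷ legsSet J) ≡ (∣ J ∣ + 1) ⊓ n
  rank-tip-legs J (i , i∈J) with ∣ J ∣ ≟ n
  ... | yes ∣J∣≡n = subst (λ (K : Subset n) → r (true ∷ legsSet K) ≡ (∣ K ∣ + 1) ⊓ n)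
                          (sym (∣p∣≡n⇒p≡⊤ {p = J} ∣J∣≡n)) (begin
    r (true ∷ legsSet {n} ⊤) ≡⟨ cong (λ Z → r (true ∷ Z)) (legsSet-⊤ n) ⟩
    r ⊤                    ≡⟨ rank-⊤ ⟩
    n                      ≡⟨ m≥n⇒m⊓n≡n (m≤m+n n 1) ⟨
    (n + 1) ⊓ n            ≡⟨ cong (λ k → (k + 1) ⊓ n) (∣⊤∣≡n n) ⟨
    (∣ ⊤ {n} ∣ + 1) ⊓ n    ∎)
    where open ≡-Reasoning
  ... | no  ∣J∣≢n = begin
    r (true ∷ legsSet J)  ≡⟨ rank-tip-full-leg (legsSet J) i (legsSet-mono (⁅⁆⊆ i∈J)) ⟩
    r (false ∷ legsSet J) ≡⟨ rank-legs J (i , i∈J) (∣J∣≢n ∘ λ J≡⊤ → trans (cong ∣_∣ J≡⊤) (∣⊤∣≡n n)) ⟩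
    ∣ J ∣ + 1             ≡⟨ m≤n⇒m⊓n≡m (subst (_≤ n) (+-comm 1 ∣ J ∣) (≤∧≢⇒< (∣p∣≤n J) ∣J∣≢n)) ⟨
    (∣ J ∣ + 1) ⊓ n       ∎
    where open ≡-Reasoning

  rank-tip : ∀ X → 1 ≤ legCount n X → r (true ∷ X) ≡ (legCount n X + 1) ⊓ n
  rank-tip X 1≤legCount = begin
    r (true ∷ X)                        ≡⟨ rank-tip-legsMet X ⟩
    r (true ∷ legsSet (legsMet n X))
      ≡⟨ rank-tip-legs (legsMet n X) (1≤∣p∣⇒Nonempty _ (subst (1 ≤_) ∣met∣ 1≤legCount)) ⟩
    (∣ legsMet n X ∣ + 1) ⊓ n           ≡⟨ cong (λ k → (k + 1) ⊓ n) ∣met∣ ⟨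
    (legCount n X + 1) ⊓ n              ∎
    where
    open ≡-Reasoning
    ∣met∣ = legCount≡∣legsMet∣ n X

  n≤1+rank : ∀ X → legCount n X ≡ n → n ≤ r (false ∷ X) + 1
  n≤1+rank X lc≡n = begin
    n                        ≡⟨ m≥n⇒m⊓n≡n (m≤m+n n 1) ⟨
    (n + 1) ⊓ n              ≡⟨ cong (λ k → (k + 1) ⊓ n) lc≡n ⟨
    (legCount n X + 1) ⊓ n   ≡⟨ rank-tip X (subst (1 ≤_) (sym lc≡n) (≤-trans (s≤s z≤n) 3≤n)) ⟨
    r (true ∷ X)             ≤⟨ rank-tip≤rank+1 X ⟩
    r (false ∷ X) + 1        ∎
    where open ≤-Reasoning

  rank-transSet : ∀ v → r (false ∷ transSet v) ≡ n ∸ ⟦ 𝒯 v ⟧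
  rank-transSet v with 𝒯 v in 𝒯v
  ... | true  = ≤-antisym (<⇒≤∸1 rT<n) (subst (n ∸ 1 ≤_) (m+n∸n≡m rT 1) (∸-monoˡ-≤ 1 n≤rT+1))
    where
    rT = r (false ∷ transSet v)
    rT<n : rT < n
    rT<n = Equivalence.from (dependent⇔ v) 𝒯v
    n≤rT+1 : n ≤ rT + 1
    n≤rT+1 = n≤1+rank (transSet v) (legCount-transSet n v)
  ... | false = ≤-antisym (≤-trans (rank-≤ N _) (≤-reflexive (∣transSet∣ n v))) (≮⇒≥ rT≮n)
    where
    rT≮n : ¬ r (false ∷ transSet v) < n
    rT≮n rT<n with () ← trans (sym 𝒯v) (Equivalence.to (dependent⇔ v) rT<n)

  rank-full-leg : ∀ X → hasFullLeg n X ≡ true → r (false ∷ X) ≡ (legCount n X + 1) ⊓ n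
  rank-full-leg X hf with hasFullLeg⇒sides n X hf
  ... | i , both = trans (sym (rank-tip-full-leg X i (sides⇒leg⊆ i both)))
                         (rank-tip X (≤-trans (hasFullLeg⇒1≤fullLegCount n X hf)
                                              (fullLegCount≤legCount n X)))

  rank-partial-transversal : ∀ X → hasFullLeg n X ≡ false → legCount n X < n →
                             r (false ∷ X) ≡ legCount n X
  rank-partial-transversal X hf lc<n = ≤-antisym upper lower
    where
    upper : r (false ∷ X) ≤ legCount n X
    upper = begin
      r (false ∷ X)                     ≤⟨ rank-≤ N (false ∷ X) ⟩
      ∣ X ∣                             ≡⟨ ∣∣≡legCount+fullLegCount n X ⟩
      legCount n X + fullLegCount n X   ≡⟨ cong (legCount n X +_) (¬hasFullLeg⇒fullLegCount≡0 n X hf) ⟩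
      legCount n X + 0                  ≡⟨ +-identityʳ _ ⟩
      legCount n X                      ∎
      where open ≤-Reasoning
    lower : legCount n X ≤ r (false ∷ X)
    lower with legCount n X in lc≡
    ... | zero  = z≤n
    ... | suc k = +-cancelʳ-≤ 1 (suc k) _ (begin
      suc k + 1              ≡⟨ m≤n⇒m⊓n≡m (subst (_≤ n) (+-comm 1 (suc k)) lc<n) ⟨
      (suc k + 1) ⊓ n        ≡⟨ cong (λ l → (l + 1) ⊓ n) lc≡ ⟨
      (legCount n X + 1) ⊓ n ≡⟨ rank-tip X (subst (1 ≤_) (sym lc≡) (s≤s z≤n)) ⟨
      r (true ∷ X)           ≤⟨ rank-tip≤rank+1 X ⟩
      r (false ∷ X) + 1      ∎)
      where open ≤-Reasoning

  rank≡ρ : ∀ X → r (false ∷ X) ≡ ρ (false ∷ X)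
  rank≡ρ X with asTransversal n X in asT
  ... | just v = begin
    r (false ∷ X)                   ≡⟨ cong (λ Z → r (false ∷ Z)) X≡T ⟩
    r (false ∷ transSet v)          ≡⟨ rank-transSet v ⟩
    n ∸ ⟦ 𝒯 v ⟧
      ≡⟨ cong (_∸ ⟦ 𝒯 v ⟧) (trans (cong (freeRank false) X≡T) (freeRank-transSet v)) ⟨
    freeRank false X ∸ ⟦ 𝒯 v ⟧      ∎
    where
    open ≡-Reasoning
    X≡T = asTransversal-sound n X asT
  ... | nothing with hasFullLeg n X in hf
  ...   | true  = rank-full-leg X hf
  ...   | false = begin
    r (false ∷ X)                   ≡⟨ rank-partial-transversal X hf lc<n ⟩
    legCount n X                    ≡⟨ m≤n⇒m⊓n≡m (<⇒≤ lc<n) ⟨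
    legCount n X ⊓ n                ≡⟨ cong (_⊓ n) (+-identityʳ _) ⟨
    (legCount n X + 0) ⊓ n          ∎
    where
    open ≡-Reasoning
    lc<n : legCount n X < n
    lc<n = ≤∧≢⇒< (legCount≤n n X) λ lc≡n → case asTransversal-complete n X lc≡n hf of λ where
      (v , asT′) → contradiction (trans (sym asT) asT′) λ ()

lemma2p3 : (n : ℕ) → 3 ≤ n → (𝒯 : Vec Bool n → Bool) →
    (∀ (T₁ T₂ : Vec Bool n) → 𝒯 T₁ ≡ true → 𝒯 T₂ ≡ true → ∣ transSet T₁ ─ transSet T₂ ∣ ≢ 1) →
    Σ (Matroid (n Data.Nat.* 2)) λ M →
      (IsSpike n M × DepTransversalsAre M 𝒯)
      × (∀ M' → IsSpike n M' → DepTransversalsAre M' 𝒯 → SameMatroid M' M)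
lemma2p3 n 3≤n 𝒯 separated = M separated 1≤n , (spike , dependent⇔ 1≤n) , unique
  where
  open Construction n 𝒯
  1≤n : 1 ≤ n
  1≤n = ≤-trans (s≤s z≤n) 3≤n
  spike : IsSpike n (M separated 1≤n)
  spike = N separated 1≤n , ρ-⊤ , tip-leg-circuit separated 1≤n 3≤n , ρ-legs 1≤n , λ _ → refl
  unique : ∀ M′ → IsSpike n M′ → DepTransversalsAre M′ 𝒯 → SameMatroid M′ (M separated 1≤n)
  unique M′ (N′ , rank-⊤ , circuits , rank-legs , M′=N′∖t) dep X =
    trans (M′=N′∖t X) (Uniqueness.rank≡ρ n 𝒯 3≤n N′ rank-⊤ circuits rank-legs dep′ X)
    where
    dep′ : ∀ v → rank N′ (false ∷ transSet v) < n ⇔ 𝒯 v ≡ true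
    dep′ v = subst₂ (λ a b → a < b ⇔ 𝒯 v ≡ true) (M′=N′∖t (transSet v)) (∣transSet∣ n v) (dep v)
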